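{- Let $X$ be a graph on vertex set $\{1,\dots,v\}$ with adjacency matrix $A(X)$, and let $1\le k\le v$. Then the adjacency matrix of the symmetric $k$-th power $X^{\{k\}}$ (with rows and columns indexed by the increasing $k$-tuples, i.e. $k$-subsets) is \[ A(X^{\{k\}})=\frac{1}{(k-1)!}\,P^{(k)}\left(A(X)\otimes I_v^{\otimes (k-1)}\right)P^{(k)*}. \]
   Context: The symmetric $k$-th power $X^{\{k\}}$ has as vertices the $k$-subsets of $V(X)$, two $k$-subsets being adjacent iff their symmetric difference is an edge of $X$. $P^{(k)}$ is the $0/1$ matrix with $\binom{v}{k}$ rows indexed by $k$-tuples $(i,j,\dots,l)$ with $1\le i<j<\dots<l\le v$ and $v^k$ columns indexed by $k$-tuples $[i',j',\dots,l']$ with $1\le i',\dots,l'\le v$, whose entry is $1$ iff $(i,j,\dots,l)$ is a permutation of $[i',j',\dots,l']$ (and $0$ otherwise); columns are ordered compatibly with the tensor product $(\mathbb{C}^v)^{\otimes k}$, and $P^{(k)*}$ is its (conjugate) transpose. -}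

module Defs where

open import Data.Nat using (ℕ; zero; suc)
open import Data.Bool using (Bool; true; false; if_then_else_)
open import Data.Fin using (Fin; _<_)
open import Data.Fin using (_≟_)
open import Relation.Nullary using (does)
open import Data.List using (List; []; _∷_; map; concatMap; foldr; allFin)
open import Data.Vec using (Vec; []; _∷_)
open import Data.Vec.Relation.Unary.Linked using (Linked)
open import Data.Vec.Membership.Propositional using (_∈_; _∉_)
open import Data.Rational using (ℚ; 0ℚ; 1ℚ; _+_; _*_)
open import Data.Product using (Σ; _×_; ∃₂)
open import Data.Sum using (_⊎_)
open import Relation.Binary.PropositionalEquality using (_≡_)
open import Function.Bundles using (_⇔_)

record Graph (v : ℕ) : Set where
  field
    adj     : Fin v → Fin v → Bool
    adj-sym : ∀ i j → adj i j ≡ adj j i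
    irrefl  : ∀ i → adj i i ≡ false
open Graph public

Mat : Set → Set → Set
Mat I J = I → J → ℚ

Σ[_]_ : {J : Set} → List J → (J → ℚ) → ℚ
Σ[ js ] f = foldr (λ j acc → f j + acc) 0ℚ js

mul : {I J K : Set} → List J → Mat I J → Mat J K → Mat I K
mul js M N i k = Σ[ js ] (λ j → M i j * N j k)

-- Transpose (= conjugate transpose, entries are rational).
_ᵀ : {I J : Set} → Mat I J → Mat J I
(M ᵀ) j i = M i j

allTuples : (v k : ℕ) → List (Vec (Fin v) k)
allTuples v zero = [] ∷ []
allTuples v (suc k) = concatMap (λ i → map (i ∷_) (allTuples v k)) (allFin v)

adjMat : {v : ℕ} → Graph v → Mat (Fin v) (Fin v)
adjMat X i j = if adj X i j then 1ℚ else 0ℚ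

idMat : (v : ℕ) → Mat (Fin v) (Fin v)
idMat v i j = if does (i ≟ j) then 1ℚ else 0ℚ

-- Kronecker product A ⊗ B, tuple indices: first tensor factor = first coordinate.
_⊗_ : {v m : ℕ} → Mat (Fin v) (Fin v) → Mat (Vec (Fin v) m) (Vec (Fin v) m)
    → Mat (Vec (Fin v) (suc m)) (Vec (Fin v) (suc m))
(A ⊗ B) (i ∷ is) (j ∷ js) = A i j * B is js

_⊗^_ : {v : ℕ} → Mat (Fin v) (Fin v) → (m : ℕ) → Mat (Vec (Fin v) m) (Vec (Fin v) m)
(B ⊗^ zero) [] [] = 1ℚ
(B ⊗^ suc m) = B ⊗ (B ⊗^ m)

-- Increasing k-tuples (i < j < … < l), i.e. k-subsets of Fin v.
Increasing : {v k : ℕ} → Vec (Fin v) k → Set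
Increasing s = Linked _<_ s

SymPowAdj : {v k : ℕ} → Graph v → Vec (Fin v) k → Vec (Fin v) k → Set
SymPowAdj {v} X s t =
  ∃₂ λ (a b : Fin v) → adj X a b ≡ true ×
    (∀ x → ((x ∈ s × x ∉ t) ⊎ (x ∈ t × x ∉ s)) ⇔ (x ≡ a ⊎ x ≡ b))

open import Data.List.Relation.Binary.Permutation.Propositional using (_↭_)
IsPermOf : {v k : ℕ} → Vec (Fin v) k → Vec (Fin v) k → Set
IsPermOf s c = Data.Vec.toList s ↭ Data.Vec.toList c

-- For increasing s and t, row s of P^{(k)} is the indicator of the permutations
-- of s, so, writing a tuple as c ∷ r, the (s, t) entry of
-- P^{(k)} (A ⊗ I^{⊗(k-1)}) P^{(k)*} counts the triples (c, r, d) with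
-- s ↭ c ∷ r, t ↭ d ∷ r and cd an edge of X.  Such a triple exists iff the
-- symmetric difference of s and t is the edge cd; then c and d are forced and
-- r runs over the (k-1)! orderings of s ∖ {c}.
module Submission where

open import Defs
open import Data.Nat using (ℕ; suc; _≤_)
open import Data.Nat.Properties using (_!≢0)
open import Data.Nat.Combinatorics using ()
open import Data.Nat using (_!)
open import Data.Fin using (Fin)
open import Data.Vec using (Vec)
open import Data.Integer using (+_)
open import Data.Rational using (ℚ; 0ℚ; 1ℚ; _/_; _*_)
open import Data.Product using (_×_)
open import Relation.Nullary using (¬_)
open import Relation.Binary.PropositionalEquality using (_≡_)

open import Data.Bool using (true; false; if_then_else_)
open import Data.Empty using (⊥-elim)
open import Data.Fin as Fin using (zero; suc) renaming (_≟_ to _≟ᶠ_)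
import Data.Fin.Properties as Finₚ
import Data.Integer as ℤ
open import Data.List as List using (List; []; _∷_; _++_; map; concatMap; allFin; length)
import Data.List.Properties as Listₚ
open import Data.List.Membership.Propositional using (_∈_; _∉_)
open import Data.List.Membership.Propositional.Properties using (∈-∃++)
open import Data.List.Membership.Propositional.Properties.WithK using (unique∧set⇒bag)
open import Data.List.Relation.Binary.BagAndSetEquality using (∼bag⇒↭)
open import Data.List.Relation.Binary.Permutation.Propositional
  using (_↭_; ↭-refl; ↭-prep; ↭-sym; ↭-trans; ↭⇒↭ₛ)
open import Data.List.Relation.Binary.Permutation.Propositional.Properties
  using (∈-resp-↭; ↭-length; shift; drop-∷; ¬x∷xs↭[])
import Data.List.Relation.Binary.Permutation.Setoid.Properties as Permutationₛ
open import Data.List.Relation.Binary.Subset.Propositional using (_⊆_)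
open import Data.List.Relation.Unary.All as All using ()
open import Data.List.Relation.Unary.AllPairs as AllPairs using ([]; _∷_)
open import Data.List.Relation.Unary.Any as Any using (here; there)
import Data.List.Relation.Unary.Linked as ListLinked
open import Data.List.Relation.Unary.Linked.Properties using (Linked⇒AllPairs)
open import Data.List.Relation.Unary.Unique.Propositional using (Unique)
open import Data.List.Relation.Unary.Unique.Propositional.Properties using (Unique[x∷xs]⇒x∉xs)
open import Data.Nat as ℕ using (zero; z≤n; s≤s)
import Data.Nat.Properties as ℕ
import Data.Nat.Coprimality as Coprime
import Data.Integer.Properties as ℤₚ
open import Data.Product as Product using (∃; ∃₂; _,_; proj₁; proj₂)
open import Data.Rational using (mkℚ; 1/_; _+_; +-0-rawMonoid)
open import Data.Rational.Properties
import Data.Rational.Unnormalised as ℚᵘ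
import Data.Rational.Unnormalised.Properties as ℚᵘ
open import Data.Sum as Sum using (_⊎_; inj₁; inj₂)
open import Data.Vec using ([]; _∷_; toList)
import Data.Vec.Membership.Propositional as Vec
open import Data.Vec.Membership.Propositional.Properties using (∈-toList⁺; ∈-toList⁻)
import Data.Vec.Properties as Vecₚ
open import Data.Vec.Relation.Unary.Linked using ([]; [-]; _∷_)
open import Algebra.Bundles using (CommutativeMonoid)
open import Algebra.Definitions.RawMonoid +-0-rawMonoid using () renaming (_×_ to _·_)
open import Algebra.Properties.CommutativeSemigroup (CommutativeMonoid.commutativeSemigroup +-0-commutativeMonoid)
  using (interchange)
open import Algebra.Properties.Monoid.Mult +-0-monoid using (×-assocˡ)
open import Function using (_∘_; id)
open import Function.Bundles using (_⇔_; mk⇔; Equivalence)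
open import Function.Properties.Equivalence using () renaming (trans to ⇔-trans; sym to ⇔-sym)
open import Relation.Binary.Definitions using (DecidableEquality; Decidable)
open import Relation.Binary.PropositionalEquality
  using (_≢_; refl; sym; trans; cong; cong₂; subst; setoid; module ≡-Reasoning)
open import Relation.Nullary using (yes; no; does; contradiction)
open import Relation.Nullary.Decidable using (dec-true; dec-false)

module _ {A : Set} where

  Unique-resp-↭ : {xs ys : List A} → xs ↭ ys → Unique xs → Unique ys
  Unique-resp-↭ xs↭ys = Permutationₛ.Unique-resp-↭ (setoid A) (↭⇒↭ₛ xs↭ys)

  ∈⇒↭∷ : {x : A} {xs : List A} → x ∈ xs → ∃ λ ys → xs ↭ x ∷ ys
  ∈⇒↭∷ x∈xs with ys , zs , refl ← ∈-∃++ x∈xs = ys ++ zs , shift _ ys zs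

  Unique-⊆⇒length-≤ : {xs ys : List A} → Unique xs → xs ⊆ ys → length xs ≤ length ys
  Unique-⊆⇒length-≤ {[]} _ _ = z≤n
  Unique-⊆⇒length-≤ {x ∷ xs} {ys} ux∷xs@(_ ∷ uxs) xs⊆ys
    with zs , ys↭x∷zs ← ∈⇒↭∷ (xs⊆ys (here refl)) =
    subst (suc (length xs) ≤_) (sym (↭-length ys↭x∷zs)) (s≤s (Unique-⊆⇒length-≤ uxs xs⊆zs))
    where
    xs⊆zs : xs ⊆ zs
    xs⊆zs {y} y∈xs with ∈-resp-↭ ys↭x∷zs (xs⊆ys (there y∈xs))
    ... | here refl = contradiction y∈xs (Unique[x∷xs]⇒x∉xs ux∷xs)
    ... | there y∈zs = y∈zs

  Unique-⊆-⊇⇒↭ : {xs ys : List A} → Unique xs → Unique ys → xs ⊆ ys → ys ⊆ xs → xs ↭ ys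
  Unique-⊆-⊇⇒↭ uxs uys xs⊆ys ys⊆xs = ∼bag⇒↭ (unique∧set⇒bag uxs uys (mk⇔ xs⊆ys ys⊆xs))

  ↭∷⇒∈ : {x : A} {xs ys : List A} → xs ↭ x ∷ ys → x ∈ xs
  ↭∷⇒∈ xs↭x∷ys = ∈-resp-↭ (↭-sym xs↭x∷ys) (here refl)

  ↭∷-head-unique : {x y : A} {xs ys : List A} → Unique xs → xs ↭ x ∷ ys → xs ↭ y ∷ ys → y ≡ x
  ↭∷-head-unique uxs xs↭x∷ys xs↭y∷ys with ∈-resp-↭ xs↭x∷ys (↭∷⇒∈ xs↭y∷ys)
  ... | here y≡x = y≡x
  ... | there y∈ys = contradiction y∈ys (Unique[x∷xs]⇒x∉xs (Unique-resp-↭ xs↭y∷ys uxs))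

  -- An exchange is a pair xs ↭ c ∷ zs, ys ↭ d ∷ zs: ys arises from xs by replacing c with d.
  exchange-∈∉⇒≡ : {c d x : A} {xs ys zs : List A} → xs ↭ c ∷ zs → ys ↭ d ∷ zs →
                  x ∈ xs → x ∉ ys → x ≡ c
  exchange-∈∉⇒≡ xs↭c∷zs ys↭d∷zs x∈xs x∉ys with ∈-resp-↭ xs↭c∷zs x∈xs
  ... | here x≡c = x≡c
  ... | there x∈zs = contradiction (∈-resp-↭ (↭-sym ys↭d∷zs) (there x∈zs)) x∉ys

  exchange-head-∉ : {c d : A} {xs ys zs : List A} → Unique xs → xs ↭ c ∷ zs → ys ↭ d ∷ zs →
                    c ≢ d → c ∉ ys
  exchange-head-∉ uxs xs↭c∷zs ys↭d∷zs c≢d c∈ys with ∈-resp-↭ ys↭d∷zs c∈ys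
  ... | here c≡d = c≢d c≡d
  ... | there c∈zs = Unique[x∷xs]⇒x∉xs (Unique-resp-↭ xs↭c∷zs uxs) c∈zs

  SymDiff : List A → List A → A → Set
  SymDiff xs ys x = (x ∈ xs × x ∉ ys) ⊎ (x ∈ ys × x ∉ xs)

  exchange⇒SymDiff : {c d : A} {xs ys zs : List A} → Unique xs → Unique ys →
                     xs ↭ c ∷ zs → ys ↭ d ∷ zs → c ≢ d →
                     ∀ x → SymDiff xs ys x ⇔ (x ≡ c ⊎ x ≡ d)
  exchange⇒SymDiff uxs uys xs↭c∷zs ys↭d∷zs c≢d x = mk⇔ to from
    where
    to : SymDiff _ _ x → x ≡ _ ⊎ x ≡ _
    to (inj₁ (x∈xs , x∉ys)) = inj₁ (exchange-∈∉⇒≡ xs↭c∷zs ys↭d∷zs x∈xs x∉ys)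
    to (inj₂ (x∈ys , x∉xs)) = inj₂ (exchange-∈∉⇒≡ ys↭d∷zs xs↭c∷zs x∈ys x∉xs)
    from : x ≡ _ ⊎ x ≡ _ → SymDiff _ _ x
    from (inj₁ refl) = inj₁ (↭∷⇒∈ xs↭c∷zs , exchange-head-∉ uxs xs↭c∷zs ys↭d∷zs c≢d)
    from (inj₂ refl) = inj₂ (↭∷⇒∈ ys↭d∷zs , exchange-head-∉ uys ys↭d∷zs xs↭c∷zs (c≢d ∘ sym))

module _ {A : Set} (_≟_ : DecidableEquality A) where

  open import Data.List.Membership.DecPropositional _≟_ using (_∈?_)

  ↭-dec : Decidable (_↭_ {A = A})
  ↭-dec [] [] = yes ↭-refl
  ↭-dec [] (y ∷ ys) = no (¬x∷xs↭[] ∘ ↭-sym)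
  ↭-dec (x ∷ xs) ys with x ∈? ys
  ... | no x∉ys = no (λ x∷xs↭ys → x∉ys (∈-resp-↭ x∷xs↭ys (here refl)))
  ... | yes x∈ys with zs , ys↭x∷zs ← ∈⇒↭∷ x∈ys with ↭-dec xs zs
  ...   | yes xs↭zs = yes (↭-trans (↭-prep x xs↭zs) (↭-sym ys↭x∷zs))
  ...   | no xs↭̸zs = no (λ x∷xs↭ys → xs↭̸zs (drop-∷ (↭-trans x∷xs↭ys ys↭x∷zs)))

  exchange-⊆ : {a b : A} {xs ys zs : List A} → xs ↭ a ∷ zs → a ∉ ys →
               (∀ x → SymDiff xs ys x ⇔ (x ≡ a ⊎ x ≡ b)) → ys ⊆ b ∷ zs
  exchange-⊆ {xs = xs} xs↭a∷zs a∉ys symDiff {y} y∈ys with y ∈? xs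
  ... | yes y∈xs = there (Any.tail (λ { refl → a∉ys y∈ys }) (∈-resp-↭ xs↭a∷zs y∈xs))
  ... | no y∉xs with Equivalence.to (symDiff y) (inj₂ (y∈ys , y∉xs))
  ...   | inj₁ refl = contradiction y∈ys a∉ys
  ...   | inj₂ refl = here refl

  -- The length hypothesis excludes b ∈ xs ∖ ys, which would force ys ⊆ xs ∖ {a}.
  SymDiff⇒exchange : {a b : A} {xs ys : List A} → Unique xs → Unique ys →
                     length xs ≡ length ys → (∀ x → SymDiff xs ys x ⇔ (x ≡ a ⊎ x ≡ b)) →
                     a ∈ xs → a ∉ ys → ∃ λ zs → xs ↭ a ∷ zs × ys ↭ b ∷ zs
  SymDiff⇒exchange {a} {b} {xs} {ys} uxs uys |xs|≡|ys| symDiff a∈xs a∉ys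
    with zs , xs↭a∷zs ← ∈⇒↭∷ a∈xs
    with Equivalence.from (symDiff b) (inj₂ refl)
  ... | inj₁ (b∈xs , b∉ys) = ⊥-elim (ℕ.n≮n _ (begin-strict
    length zs         <⟨ ℕ.n<1+n _ ⟩
    suc (length zs)   ≡⟨ ↭-length xs↭a∷zs ⟨
    length xs         ≡⟨ |xs|≡|ys| ⟩
    length ys         ≤⟨ Unique-⊆⇒length-≤ uys ys⊆zs ⟩
    length zs         ∎))
    where
    open ℕ.≤-Reasoning
    ys⊆zs : ys ⊆ zs
    ys⊆zs {y} y∈ys with exchange-⊆ xs↭a∷zs a∉ys symDiff y∈ys
    ... | here refl = contradiction y∈ys b∉ys
    ... | there y∈zs = y∈zs
  ... | inj₂ (b∈ys , b∉xs) =
    zs , xs↭a∷zs , ↭-sym (Unique-⊆-⊇⇒↭ ub∷zs uys b∷zs⊆ys (exchange-⊆ xs↭a∷zs a∉ys symDiff))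
    where
    zs⊆xs : zs ⊆ xs
    zs⊆xs = ∈-resp-↭ (↭-sym xs↭a∷zs) ∘ there
    ub∷zs : Unique (b ∷ zs)
    ub∷zs = All.tabulate (λ { z∈zs refl → b∉xs (zs⊆xs z∈zs) })
          ∷ AllPairs.tail (Unique-resp-↭ xs↭a∷zs uxs)
    b∷zs⊆ys : b ∷ zs ⊆ ys
    b∷zs⊆ys (here refl) = b∈ys
    b∷zs⊆ys {z} (there z∈zs) with z ∈? ys
    ... | yes z∈ys = z∈ys
    ... | no z∉ys with Equivalence.to (symDiff z) (inj₁ (zs⊆xs z∈zs , z∉ys))
    ...   | inj₁ refl = contradiction z∈zs (Unique[x∷xs]⇒x∉xs (Unique-resp-↭ xs↭a∷zs uxs))
    ...   | inj₂ refl = contradiction (zs⊆xs z∈zs) b∉xs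

Increasing⇒Unique : {v k : ℕ} {s : Vec (Fin v) k} → Increasing s → Unique (toList s)
Increasing⇒Unique s↑ = AllPairs.map Finₚ.<⇒≢ (Linked⇒AllPairs Finₚ.<-trans (toList⁺ s↑))
  where
  toList⁺ : {v k : ℕ} {s : Vec (Fin v) k} → Increasing s → ListLinked.Linked Fin._<_ (toList s)
  toList⁺ [] = ListLinked.[]
  toList⁺ [-] = ListLinked.[-]
  toList⁺ {s = _ ∷ _ ∷ _} (x<y ∷ s↑) = x<y ListLinked.∷ toList⁺ s↑

module _ {J : Set} where

  Σ-cong : (js : List J) {f g : J → ℚ} → (∀ j → f j ≡ g j) → Σ[ js ] f ≡ Σ[ js ] g
  Σ-cong [] f≗g = refl
  Σ-cong (j ∷ js) f≗g = cong₂ _+_ (f≗g j) (Σ-cong js f≗g)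

  Σ-zero : (js : List J) {f : J → ℚ} → (∀ j → f j ≡ 0ℚ) → Σ[ js ] f ≡ 0ℚ
  Σ-zero [] f≗0 = refl
  Σ-zero (j ∷ js) f≗0 = trans (cong₂ _+_ (f≗0 j) (Σ-zero js f≗0)) (+-identityˡ 0ℚ)

  Σ-++ : (js ks : List J) (f : J → ℚ) → Σ[ js ++ ks ] f ≡ Σ[ js ] f + Σ[ ks ] f
  Σ-++ [] ks f = sym (+-identityˡ _)
  Σ-++ (j ∷ js) ks f = trans (cong (_+_ (f j)) (Σ-++ js ks f)) (sym (+-assoc (f j) _ _))

  Σ-distrib-+ : (js : List J) (f g : J → ℚ) → Σ[ js ] (λ j → f j + g j) ≡ Σ[ js ] f + Σ[ js ] g
  Σ-distrib-+ [] f g = sym (+-identityˡ 0ℚ)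
  Σ-distrib-+ (j ∷ js) f g =
    trans (cong (_+_ (f j + g j)) (Σ-distrib-+ js f g)) (interchange (f j) (g j) _ _)

  Σ-*-distribʳ : (js : List J) (f : J → ℚ) (c : ℚ) → Σ[ js ] f * c ≡ Σ[ js ] (λ j → f j * c)
  Σ-*-distribʳ [] f c = *-zeroˡ c
  Σ-*-distribʳ (j ∷ js) f c = trans (*-distribʳ-+ c (f j) _) (cong (_+_ (f j * c)) (Σ-*-distribʳ js f c))

module _ {I J : Set} where

  Σ-map : (h : I → J) (is : List I) (f : J → ℚ) → Σ[ map h is ] f ≡ Σ[ is ] (f ∘ h)
  Σ-map h [] f = refl
  Σ-map h (i ∷ is) f = cong (_+_ (f (h i))) (Σ-map h is f)

  Σ-concatMap : (h : I → List J) (is : List I) (f : J → ℚ) →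
                Σ[ concatMap h is ] f ≡ Σ[ is ] (λ i → Σ[ h i ] f)
  Σ-concatMap h [] f = refl
  Σ-concatMap h (i ∷ is) f =
    trans (Σ-++ (h i) (concatMap h is) f) (cong (_+_ (Σ[ h i ] f)) (Σ-concatMap h is f))

  Σ-swap : (is : List I) (js : List J) (f : I → J → ℚ) →
           Σ[ is ] (λ i → Σ[ js ] (f i)) ≡ Σ[ js ] (λ j → Σ[ is ] (λ i → f i j))
  Σ-swap [] js f = sym (Σ-zero js (λ _ → refl))
  Σ-swap (i ∷ is) js f = trans (cong (_+_ (Σ[ js ] (f i))) (Σ-swap is js f)) (sym (Σ-distrib-+ js (f i) _))

Σ-tabulate : {J : Set} {n : ℕ} (g : Fin n → J) (f : J → ℚ) → Σ[ List.tabulate g ] f ≡ Σ[ allFin n ] (f ∘ g)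
Σ-tabulate {n = n} g f = trans (cong (Σ[_] f) (sym (Listₚ.map-tabulate id g))) (Σ-map g (allFin n) f)

Σ-allFin-single : (n : ℕ) (f : Fin n → ℚ) (i : Fin n) → (∀ j → j ≢ i → f j ≡ 0ℚ) → Σ[ allFin n ] f ≡ f i
Σ-allFin-single (suc n) f zero f≗0 =
  trans (cong (_+_ (f zero)) (trans (Σ-tabulate suc f) (Σ-zero (allFin n) (λ j → f≗0 (suc j) λ ()))))
        (+-identityʳ _)
Σ-allFin-single (suc n) f (suc i) f≗0 =
  trans (cong₂ _+_ (f≗0 zero λ ()) (trans (Σ-tabulate suc f) (Σ-allFin-single n (f ∘ suc) i
          (λ j j≢i → f≗0 (suc j) (j≢i ∘ Finₚ.suc-injective)))))
        (+-identityˡ _)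

module _ {v : ℕ} where

  Σ-allTuples-suc : (n : ℕ) (f : Vec (Fin v) (suc n) → ℚ) →
                    Σ[ allTuples v (suc n) ] f ≡ Σ[ allFin v ] (λ x → Σ[ allTuples v n ] (λ r → f (x ∷ r)))
  Σ-allTuples-suc n f =
    trans (Σ-concatMap _ (allFin v) f) (Σ-cong (allFin v) (λ x → Σ-map (x ∷_) (allTuples v n) f))

  Σ-allTuples-single : (n : ℕ) (f : Vec (Fin v) n → ℚ) (r : Vec (Fin v) n) →
                       (∀ r′ → r′ ≢ r → f r′ ≡ 0ℚ) → Σ[ allTuples v n ] f ≡ f r
  Σ-allTuples-single zero f [] _ = +-identityʳ _
  Σ-allTuples-single (suc n) f (x ∷ r) f≗0 =
    trans (Σ-allTuples-suc n f)
      (trans (Σ-allFin-single v _ x λ y y≢x →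
                Σ-zero (allTuples v n) (λ r′ → f≗0 (y ∷ r′) (y≢x ∘ Vecₚ.∷-injectiveˡ)))
             (Σ-allTuples-single n (f ∘ (x ∷_)) r λ r′ r′≢r →
                f≗0 (x ∷ r′) (r′≢r ∘ Vecₚ.∷-injectiveʳ)))

module _ {v : ℕ} where

  idMat-diagonal : (i : Fin v) → idMat v i i ≡ 1ℚ
  idMat-diagonal i = cong (if_then 1ℚ else 0ℚ) (dec-true (i ≟ᶠ i) refl)

  idMat-offDiagonal : {i j : Fin v} → i ≢ j → idMat v i j ≡ 0ℚ
  idMat-offDiagonal {i} {j} i≢j = cong (if_then 1ℚ else 0ℚ) (dec-false (i ≟ᶠ j) i≢j)

  ⊗^-identity-diagonal : (m : ℕ) (r : Vec (Fin v) m) → (idMat v ⊗^ m) r r ≡ 1ℚ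
  ⊗^-identity-diagonal zero [] = refl
  ⊗^-identity-diagonal (suc m) (x ∷ r) = cong₂ _*_ (idMat-diagonal x) (⊗^-identity-diagonal m r)

  ⊗^-identity-offDiagonal : (m : ℕ) {r r′ : Vec (Fin v) m} → r ≢ r′ → (idMat v ⊗^ m) r r′ ≡ 0ℚ
  ⊗^-identity-offDiagonal zero {[]} {[]} []≢[] = contradiction refl []≢[]
  ⊗^-identity-offDiagonal (suc m) {x ∷ r} {y ∷ r′} x∷r≢y∷r′ with x ≟ᶠ y
  ... | no _ = *-zeroˡ ((idMat v ⊗^ m) r r′)
  ... | yes refl = trans (cong (_*_ 1ℚ) (⊗^-identity-offDiagonal m (x∷r≢y∷r′ ∘ cong (x ∷_)))) (*-zeroʳ 1ℚ)

  Σ-⊗^-identity : (m : ℕ) (F : ℚ → Vec (Fin v) m → ℚ) → (∀ r′ → F 0ℚ r′ ≡ 0ℚ) →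
                  (r : Vec (Fin v) m) →
                  Σ[ allTuples v m ] (λ r′ → F ((idMat v ⊗^ m) r r′) r′) ≡ F 1ℚ r
  Σ-⊗^-identity m F F0≗0 r =
    trans (Σ-allTuples-single m _ r λ r′ r′≢r →
             trans (cong (λ e → F e r′) (⊗^-identity-offDiagonal m (r′≢r ∘ sym))) (F0≗0 r′))
          (cong (λ e → F e r) (⊗^-identity-diagonal m r))

  mul-⊗-identity : {I : Set} (m : ℕ) (P Q : Mat I (Vec (Fin v) (suc m))) (M : Mat (Fin v) (Fin v)) (i j : I) →
    mul (allTuples v (suc m)) (mul (allTuples v (suc m)) P (M ⊗ (idMat v ⊗^ m))) (Q ᵀ) i j
      ≡ Σ[ allFin v ] λ c → Σ[ allTuples v m ] λ r → Σ[ allFin v ] λ d → P i (c ∷ r) * M c d * Q j (d ∷ r)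
  mul-⊗-identity m P Q M i j = begin
    Σ[ L ] (λ d → Σ[ L ] (λ c → P i c * B c d) * Q j d)
      ≡⟨ Σ-cong L (λ d → Σ-*-distribʳ L (λ c → P i c * B c d) (Q j d)) ⟩
    Σ[ L ] (λ d → Σ[ L ] (λ c → P i c * B c d * Q j d))
      ≡⟨ Σ-swap L L (λ d c → P i c * B c d * Q j d) ⟩
    Σ[ L ] (λ c → Σ[ L ] (λ d → P i c * B c d * Q j d))
      ≡⟨ Σ-allTuples-suc m (λ c → Σ[ L ] (λ d → P i c * B c d * Q j d)) ⟩
    Σ[ allFin v ] (λ c → Σ[ allTuples v m ] λ r → Σ[ L ] (λ d → P i (c ∷ r) * B (c ∷ r) d * Q j d))
      ≡⟨ Σ-cong (allFin v) (λ c → Σ-cong (allTuples v m) λ r →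
           Σ-allTuples-suc m (λ d → P i (c ∷ r) * B (c ∷ r) d * Q j d)) ⟩
    Σ[ allFin v ] (λ c → Σ[ allTuples v m ] λ r → Σ[ allFin v ] λ d → Σ[ allTuples v m ] λ r′ →
      P i (c ∷ r) * (M c d * (idMat v ⊗^ m) r r′) * Q j (d ∷ r′))
      ≡⟨ Σ³-cong (λ c r d →
           Σ-⊗^-identity m (λ e r′ → P i (c ∷ r) * (M c d * e) * Q j (d ∷ r′)) (zero-factor c r d) r) ⟩
    Σ[ allFin v ] (λ c → Σ[ allTuples v m ] λ r → Σ[ allFin v ] λ d → P i (c ∷ r) * (M c d * 1ℚ) * Q j (d ∷ r))
      ≡⟨ Σ³-cong (λ c r d → cong (λ e → P i (c ∷ r) * e * Q j (d ∷ r)) (*-identityʳ (M c d))) ⟩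
    Σ[ allFin v ] (λ c → Σ[ allTuples v m ] λ r → Σ[ allFin v ] λ d → P i (c ∷ r) * M c d * Q j (d ∷ r)) ∎
    where
    open ≡-Reasoning
    L = allTuples v (suc m)
    B = M ⊗ (idMat v ⊗^ m)
    Σ³-cong : {f g : Fin v → Vec (Fin v) m → Fin v → ℚ} → (∀ c r d → f c r d ≡ g c r d) →
              Σ[ allFin v ] (λ c → Σ[ allTuples v m ] λ r → Σ[ allFin v ] (f c r))
              ≡ Σ[ allFin v ] (λ c → Σ[ allTuples v m ] λ r → Σ[ allFin v ] (g c r))
    Σ³-cong f≗g = Σ-cong (allFin v) λ c → Σ-cong (allTuples v m) λ r → Σ-cong (allFin v) (f≗g c r)
    zero-factor : ∀ c r d r′ → P i (c ∷ r) * (M c d * 0ℚ) * Q j (d ∷ r′) ≡ 0ℚ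
    zero-factor c r d r′ = trans (cong (λ e → P i (c ∷ r) * e * Q j (d ∷ r′)) (*-zeroʳ (M c d)))
                                 (trans (cong (_* Q j (d ∷ r′)) (*-zeroʳ (P i (c ∷ r)))) (*-zeroˡ (Q j (d ∷ r′))))

IsPermIndicator : {v n : ℕ} → List (Fin v) → (Vec (Fin v) n → ℚ) → Set
IsPermIndicator u f = ∀ r → (u ↭ toList r → f r ≡ 1ℚ) × (¬ (u ↭ toList r) → f r ≡ 0ℚ)

module _ {v : ℕ} where

  Σ-allFin-extract : (g : Fin v → ℚ) (y : Fin v) →
                     Σ[ allFin v ] g ≡ g y + Σ[ allFin v ] (λ x → if does (x ≟ᶠ y) then 0ℚ else g x)
  Σ-allFin-extract g y = begin
    Σ[ allFin v ] g
      ≡⟨ Σ-cong (allFin v) split ⟩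
    Σ[ allFin v ] (λ x → at x + off x)
      ≡⟨ Σ-distrib-+ (allFin v) at off ⟩
    Σ[ allFin v ] at + Σ[ allFin v ] off
      ≡⟨ cong (_+ Σ[ allFin v ] off) (Σ-allFin-single v at y at-off) ⟩
    at y + Σ[ allFin v ] off
      ≡⟨ cong (λ b → (if b then g y else 0ℚ) + Σ[ allFin v ] off) (dec-true (y ≟ᶠ y) refl) ⟩
    g y + Σ[ allFin v ] off ∎
    where
    open ≡-Reasoning
    at off : Fin v → ℚ
    at x = if does (x ≟ᶠ y) then g x else 0ℚ
    off x = if does (x ≟ᶠ y) then 0ℚ else g x
    split : ∀ x → g x ≡ at x + off x
    split x with does (x ≟ᶠ y)
    ... | true = sym (+-identityʳ (g x))
    ... | false = sym (+-identityˡ (g x))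
    at-off : ∀ x → x ≢ y → at x ≡ 0ℚ
    at-off x x≢y = cong (if_then g x else 0ℚ) (dec-false (x ≟ᶠ y) x≢y)

  Σ-allFin-constantOn : (u : List (Fin v)) → Unique u → (g : Fin v → ℚ) (c : ℚ) →
                        (∀ x → x ∈ u → g x ≡ c) → (∀ x → x ∉ u → g x ≡ 0ℚ) →
                        Σ[ allFin v ] g ≡ length u · c
  Σ-allFin-constantOn [] _ g c _ g≗0 = Σ-zero (allFin v) (λ x → g≗0 x λ ())
  Σ-allFin-constantOn (y ∷ u) uy∷u g c g≗c g≗0 =
    trans (Σ-allFin-extract g y)
          (cong₂ _+_ (g≗c y (here refl))
                     (Σ-allFin-constantOn u (AllPairs.tail uy∷u) _ c g′≗c g′≗0))
    where
    g′≗c : ∀ x → x ∈ u → (if does (x ≟ᶠ y) then 0ℚ else g x) ≡ c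
    g′≗c x x∈u with x ≟ᶠ y
    ... | yes refl = contradiction x∈u (Unique[x∷xs]⇒x∉xs uy∷u)
    ... | no _ = g≗c x (there x∈u)
    g′≗0 : ∀ x → x ∉ u → (if does (x ≟ᶠ y) then 0ℚ else g x) ≡ 0ℚ
    g′≗0 x x∉u with x ≟ᶠ y
    ... | yes _ = refl
    ... | no x≢y = g≗0 x λ { (here x≡y) → x≢y x≡y ; (there x∈u) → x∉u x∈u }

  Σ-permIndicator : (n : ℕ) (u : List (Fin v)) → Unique u → length u ≡ n →
                    (f : Vec (Fin v) n → ℚ) → IsPermIndicator u f → Σ[ allTuples v n ] f ≡ (n !) · 1ℚ
  Σ-permIndicator zero [] _ _ f f-ind = cong (_+ 0ℚ) (proj₁ (f-ind []) ↭-refl)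
  Σ-permIndicator (suc n) u uu |u|≡1+n f f-ind = begin
    Σ[ allTuples v (suc n) ] f
      ≡⟨ Σ-allTuples-suc n f ⟩
    Σ[ allFin v ] (λ x → Σ[ allTuples v n ] (λ r → f (x ∷ r)))
      ≡⟨ Σ-allFin-constantOn u uu _ ((n !) · 1ℚ) rest-count rest-zero ⟩
    length u · ((n !) · 1ℚ)
      ≡⟨ cong (_· ((n !) · 1ℚ)) |u|≡1+n ⟩
    suc n · ((n !) · 1ℚ)
      ≡⟨ ×-assocˡ 1ℚ (suc n) (n !) ⟩
    (suc n !) · 1ℚ ∎
    where
    open ≡-Reasoning
    rest-count : ∀ x → x ∈ u → Σ[ allTuples v n ] (λ r → f (x ∷ r)) ≡ (n !) · 1ℚ
    rest-count x x∈u with u′ , u↭x∷u′ ← ∈⇒↭∷ x∈u =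
      Σ-permIndicator n u′ (AllPairs.tail (Unique-resp-↭ u↭x∷u′ uu))
        (ℕ.suc-injective (trans (sym (↭-length u↭x∷u′)) |u|≡1+n)) (f ∘ (x ∷_))
        (λ r → (λ u′↭r → proj₁ (f-ind (x ∷ r)) (↭-trans u↭x∷u′ (↭-prep x u′↭r)))
             , (λ u′↭̸r → proj₂ (f-ind (x ∷ r)) λ u↭x∷r →
                  u′↭̸r (drop-∷ (↭-trans (↭-sym u↭x∷u′) u↭x∷r))))
    rest-zero : ∀ x → x ∉ u → Σ[ allTuples v n ] (λ r → f (x ∷ r)) ≡ 0ℚ
    rest-zero x x∉u =
      Σ-zero (allTuples v n) (λ r → proj₂ (f-ind (x ∷ r)) (λ u↭x∷r → x∉u (↭∷⇒∈ u↭x∷r)))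

fromℕ : ℕ → ℚ
fromℕ n = mkℚ (+ n) 0 (Coprime.sym (Coprime.1-coprimeTo n))

·1ℚ≡fromℕ : (n : ℕ) → n · 1ℚ ≡ fromℕ n
·1ℚ≡fromℕ zero = refl
·1ℚ≡fromℕ (suc n) = trans (cong (_+_ 1ℚ) (·1ℚ≡fromℕ n))
  (toℚᵘ-injective (ℚᵘ.≃-trans (toℚᵘ-homo-+ 1ℚ (fromℕ n)) (ℚᵘ.*≡* cross-multiplied)))
  where
  cross-multiplied : ((+ 1 ℤ.* + 1) ℤ.+ + n ℤ.* + 1) ℤ.* + 1 ≡ + suc n ℤ.* (+ 1 ℤ.* + 1)
  cross-multiplied =
    trans (ℤₚ.*-identityʳ _) (trans (cong (ℤ._+_ (+ 1)) (ℤₚ.*-identityʳ (+ n))) (sym (ℤₚ.*-identityʳ _)))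

-- 1/ fromℕ n is in lowest terms, so ↥p/↧p≡p identifies it with + 1 / n.
1/n*n·1ℚ≡1 : (n : ℕ) .{{_ : ℕ.NonZero n}} → ((+ 1) / n) * (n · 1ℚ) ≡ 1ℚ
1/n*n·1ℚ≡1 n@(suc k) = trans (cong₂ _*_ (↥p/↧p≡p (1/ fromℕ n)) (·1ℚ≡fromℕ n)) (*-inverseˡ (fromℕ n))

module _ {A : Set} {k : ℕ} where

  Vec-SymDiff⇔SymDiff : (s t : Vec A k) (x : A) →
                        ((x Vec.∈ s × x Vec.∉ t) ⊎ (x Vec.∈ t × x Vec.∉ s)) ⇔ SymDiff (toList s) (toList t) x
  Vec-SymDiff⇔SymDiff s t x = mk⇔ (Sum.map toList⁺ toList⁺) (Sum.map toList⁻ toList⁻)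
    where
    toList⁺ : {xs ys : Vec A k} → x Vec.∈ xs × x Vec.∉ ys → x ∈ toList xs × x ∉ toList ys
    toList⁺ = Product.map ∈-toList⁺ (_∘ ∈-toList⁻)
    toList⁻ : {xs ys : Vec A k} → x ∈ toList xs × x ∉ toList ys → x Vec.∈ xs × x Vec.∉ ys
    toList⁻ = Product.map ∈-toList⁻ (_∘ ∈-toList⁺)

module _ {v : ℕ} (X : Graph v) where

  adjMat-edge : {i j : Fin v} → adj X i j ≡ true → adjMat X i j ≡ 1ℚ
  adjMat-edge ij = cong (if_then 1ℚ else 0ℚ) ij

  adj⇒≢ : {i j : Fin v} → adj X i j ≡ true → i ≢ j
  adj⇒≢ {i} ij refl with () ← trans (sym ij) (irrefl X i)

  module _ {m : ℕ} {s t : Vec (Fin v) (suc m)} (us : Unique (toList s)) (ut : Unique (toList t)) where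

    exchange⇒SymPowAdj : {c d : Fin v} {zs : List (Fin v)} → toList s ↭ c ∷ zs → toList t ↭ d ∷ zs →
                         adj X c d ≡ true → SymPowAdj X s t
    exchange⇒SymPowAdj s↭c∷zs t↭d∷zs cd = _ , _ , cd , λ x →
      ⇔-trans (Vec-SymDiff⇔SymDiff s t x) (exchange⇒SymDiff us ut s↭c∷zs t↭d∷zs (adj⇒≢ cd) x)

    SymPowAdj⇒exchange : SymPowAdj X s t →
                         ∃₂ λ a b → adj X a b ≡ true × ∃ λ zs → toList s ↭ a ∷ zs × toList t ↭ b ∷ zs
    SymPowAdj⇒exchange (a , b , ab , symDiff) = orient (Equivalence.from (symDiffₗ a) (inj₁ refl))
      where
      |s|≡|t| : length (toList s) ≡ length (toList t)
      |s|≡|t| = trans (Vecₚ.length-toList s) (sym (Vecₚ.length-toList t))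
      symDiffₗ : ∀ x → SymDiff (toList s) (toList t) x ⇔ (x ≡ a ⊎ x ≡ b)
      symDiffₗ x = ⇔-trans (⇔-sym (Vec-SymDiff⇔SymDiff s t x)) (symDiff x)
      symDiffᵣ : ∀ x → SymDiff (toList t) (toList s) x ⇔ (x ≡ a ⊎ x ≡ b)
      symDiffᵣ x = mk⇔ (Equivalence.to (symDiffₗ x) ∘ Sum.swap) (Sum.swap ∘ Equivalence.from (symDiffₗ x))
      orient : SymDiff (toList s) (toList t) a →
               ∃₂ λ a b → adj X a b ≡ true × ∃ λ zs → toList s ↭ a ∷ zs × toList t ↭ b ∷ zs
      orient (inj₁ (a∈s , a∉t)) = a , b , ab , SymDiff⇒exchange _≟ᶠ_ us ut |s|≡|t| symDiffₗ a∈s a∉t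
      orient (inj₂ (a∈t , a∉s)) =
        b , a , trans (adj-sym X b a) ab ,
        Product.map₂ Product.swap (SymDiff⇒exchange _≟ᶠ_ ut us (sym |s|≡|t|) symDiffᵣ a∈t a∉s)

    module _ {p q : Vec (Fin v) (suc m) → ℚ}
             (p-ind : IsPermIndicator (toList s) p) (q-ind : IsPermIndicator (toList t) q) where

      exchangeSum : ℚ
      exchangeSum = Σ[ allFin v ] λ c → Σ[ allTuples v m ] λ r → Σ[ allFin v ] λ d →
                    p (c ∷ r) * adjMat X c d * q (d ∷ r)

      exchangeTerm-zero : (c : Fin v) (r : Vec (Fin v) m) (d : Fin v) →
                          ¬ (toList s ↭ c ∷ toList r × toList t ↭ d ∷ toList r × adj X c d ≡ true) →
                          p (c ∷ r) * adjMat X c d * q (d ∷ r) ≡ 0ℚ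
      exchangeTerm-zero c r d no-exchange
        with ↭-dec _≟ᶠ_ (toList s) (c ∷ toList r) | ↭-dec _≟ᶠ_ (toList t) (d ∷ toList r)
      ... | no s↭̸c∷r | _ =
        trans (cong (λ e → e * adjMat X c d * q (d ∷ r)) (proj₂ (p-ind (c ∷ r)) s↭̸c∷r))
              (trans (cong (_* q (d ∷ r)) (*-zeroˡ (adjMat X c d))) (*-zeroˡ (q (d ∷ r))))
      ... | yes _ | no t↭̸d∷r =
        trans (cong (_*_ (p (c ∷ r) * adjMat X c d)) (proj₂ (q-ind (d ∷ r)) t↭̸d∷r))
              (*-zeroʳ (p (c ∷ r) * adjMat X c d))
      ... | yes s↭c∷r | yes t↭d∷r with adj X c d
      ...   | true = contradiction (s↭c∷r , t↭d∷r , refl) no-exchange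
      ...   | false = trans (cong (_* q (d ∷ r)) (*-zeroʳ (p (c ∷ r)))) (*-zeroˡ (q (d ∷ r)))

      exchangeSum-nonadjacent : ¬ SymPowAdj X s t → exchangeSum ≡ 0ℚ
      exchangeSum-nonadjacent ¬adj =
        Σ-zero (allFin v) λ c → Σ-zero (allTuples v m) λ r → Σ-zero (allFin v) λ d →
          exchangeTerm-zero c r d λ (s↭c∷r , t↭d∷r , cd) → ¬adj (exchange⇒SymPowAdj s↭c∷r t↭d∷r cd)

      exchangeSum-adjacent : SymPowAdj X s t → exchangeSum ≡ (m !) · 1ℚ
      exchangeSum-adjacent adjST with a , b , ab , R , s↭a∷R , t↭b∷R ← SymPowAdj⇒exchange adjST = begin
        exchangeSum
          ≡⟨ Σ-allFin-single v _ a (λ c c≢a → Σ-zero (allTuples v m) λ r → Σ-zero (allFin v) λ d →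
               exchangeTerm-zero c r d λ (s↭c∷r , t↭d∷r , cd) →
                 c≢a (exchange-∈∉⇒≡ s↭a∷R t↭b∷R (↭∷⇒∈ s↭c∷r)
                                    (exchange-head-∉ us s↭c∷r t↭d∷r (adj⇒≢ cd)))) ⟩
        Σ[ allTuples v m ] (λ r → Σ[ allFin v ] λ d → p (a ∷ r) * adjMat X a d * q (d ∷ r))
          ≡⟨ Σ-permIndicator m R (AllPairs.tail (Unique-resp-↭ s↭a∷R us)) |R|≡m _ ind ⟩
        (m !) · 1ℚ ∎
        where
        open ≡-Reasoning
        |R|≡m : length R ≡ m
        |R|≡m = ℕ.suc-injective (trans (sym (↭-length s↭a∷R)) (Vecₚ.length-toList s))
        ind : IsPermIndicator R (λ r → Σ[ allFin v ] λ d → p (a ∷ r) * adjMat X a d * q (d ∷ r))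
        ind r = single , none
          where
          single : R ↭ toList r → Σ[ allFin v ] (λ d → p (a ∷ r) * adjMat X a d * q (d ∷ r)) ≡ 1ℚ
          single R↭r = trans
            (Σ-allFin-single v _ b λ d d≢b → exchangeTerm-zero a r d λ (_ , t↭d∷r , _) →
              d≢b (↭∷-head-unique ut t↭b∷r t↭d∷r))
            (cong₂ _*_ (cong₂ _*_ (proj₁ (p-ind (a ∷ r)) s↭a∷r) (adjMat-edge ab))
                       (proj₁ (q-ind (b ∷ r)) t↭b∷r))
            where
            s↭a∷r : toList s ↭ a ∷ toList r
            s↭a∷r = ↭-trans s↭a∷R (↭-prep a R↭r)
            t↭b∷r : toList t ↭ b ∷ toList r
            t↭b∷r = ↭-trans t↭b∷R (↭-prep b R↭r)
          none : ¬ (R ↭ toList r) → Σ[ allFin v ] (λ d → p (a ∷ r) * adjMat X a d * q (d ∷ r)) ≡ 0ℚ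
          none R↭̸r = Σ-zero (allFin v) λ d → exchangeTerm-zero a r d λ (s↭a∷r , _ , _) →
            R↭̸r (drop-∷ (↭-trans (↭-sym s↭a∷R) s↭a∷r))

mainTheorem9 : (v m : ℕ) → suc m ≤ v → (X : Graph v)
    → (P : Mat (Vec (Fin v) (suc m)) (Vec (Fin v) (suc m)))
    → (∀ s c → Increasing s → (IsPermOf s c → P s c ≡ 1ℚ) × (¬ IsPermOf s c → P s c ≡ 0ℚ))
    → ∀ s t → Increasing s → Increasing t →
      let rhs = ((+ 1) / (m !)) {{m !≢0}} * mul (allTuples v (suc m)) (mul (allTuples v (suc m)) P (adjMat X ⊗ (idMat v ⊗^ m))) (P ᵀ) s t
      in (SymPowAdj X s t → rhs ≡ 1ℚ) × (¬ SymPowAdj X s t → rhs ≡ 0ℚ)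
mainTheorem9 v m _ X P P-ind s t s↑ t↑ =
  (λ adjST → trans (cong (_*_ 1/m!) (trans expansion (exchangeSum-adjacent X us ut s-ind t-ind adjST)))
                   (1/n*n·1ℚ≡1 (m !) {{m !≢0}})) ,
  (λ ¬adjST → trans (cong (_*_ 1/m!) (trans expansion (exchangeSum-nonadjacent X us ut s-ind t-ind ¬adjST)))
                    (*-zeroʳ 1/m!))
  where
  1/m! : ℚ
  1/m! = ((+ 1) / (m !)) {{m !≢0}}
  us : Unique (toList s)
  us = Increasing⇒Unique s↑
  ut : Unique (toList t)
  ut = Increasing⇒Unique t↑
  s-ind : IsPermIndicator (toList s) (P s)
  s-ind c = P-ind s c s↑
  t-ind : IsPermIndicator (toList t) (P t)
  t-ind c = P-ind t c t↑
  expansion : mul (allTuples v (suc m)) (mul (allTuples v (suc m)) P (adjMat X ⊗ (idMat v ⊗^ m))) (P ᵀ) s t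
              ≡ exchangeSum X us ut s-ind t-ind
  expansion = mul-⊗-identity m P P (adjMat X) s t
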